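{- Let $B$ be the block of the alignment graph of $S$ and $T$ corresponding to the runs $S[i_1\ldots i_2]$ and $T[j_1\ldots j_2]$, let $c_B=\delta(S[i_1],T[j_1])$ and $w=j_2-j_1+1$, and let $\mathsf{dist}(x,y)$ denote the distance from $(0,0)$ to $(x,y)$ in the alignment graph. Then for every $y\in[0\ldots w-1]$, $$\mathsf{dist}(i_1,j_1+y)=c_B+\min\Big(\mathsf{dist}(i_1,j_1)-c_B+y\,c_B,\ \min_{1\le y'\le y}\big(\mathsf{dist}(i_1-1,j_1+y'-1)+(y-y')c_B\big)\Big).$$
   Context: Let $S$ and $T$ be strings of lengths $N$ and $M$ over an alphabet $\Sigma$ and $\delta:\Sigma^2\to\mathbb{R}^+$. The alignment graph of $S$ and $T$ is the directed weighted graph with vertex set $[0\ldots N]\times[0\ldots M]$ in which every vertex $(i,j)\in[1\ldots N]\times[1\ldots M]$ has three entering edges, each of weight $\delta(S[i],T[j])$: from $(i-1,j)$, from $(i,j-1)$ and from $(i-1,j-1)$; there are no other edges. Thus $\mathsf{dist}(0,0)=0$ and $\mathsf{dist}(i,0)=\mathsf{dist}(0,j)=\infty$ for $i,j>0$. A run is a maximal substring consisting of a single repeated letter; the block for runs $S[i_1\ldots i_2]$, $T[j_1\ldots j_2]$ is the set of vertices $(a,b)$ with $a\in[i_1\ldots i_2]$, $b\in[j_1\ldots j_2]$.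
   Formalization: The function δ on pairs of letters takes values in the positive rationals instead of $\mathbb{R}^+$. -}

module Defs where

open import Data.Nat using (ℕ; zero; suc)
open import Data.Integer using (+_)
open import Data.Rational using (ℚ; _/_; 0ℚ; _⊓_; -_)
  renaming (_+_ to _+ℚ_; _*_ to _*ℚ_)

data ℚ∞ : Set where
  fin : ℚ → ℚ∞
  ∞   : ℚ∞

min∞ : ℚ∞ → ℚ∞ → ℚ∞
min∞ (fin a) (fin b) = fin (a ⊓ b)
min∞ (fin a) ∞ = fin a
min∞ ∞ q = q

_+∞_ : ℚ∞ → ℚ → ℚ∞
fin a +∞ c = fin (a +ℚ c)
∞ +∞ c = ∞

infixl 6 _+∞_

_·_ : ℕ → ℚ → ℚ
y · c = ((+ y) / 1) *ℚ c

_-∞_ : ℚ∞ → ℚ → ℚ∞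
q -∞ c = q +∞ (- c)

-- min_{1 ≤ y' ≤ y} f y'  (∞ for the empty range y = 0)
minFrom1To : (ℕ → ℚ∞) → ℕ → ℚ∞
minFrom1To f zero = ∞
minFrom1To f (suc y) = min∞ (minFrom1To f y) (f (suc y))

-- Strings are 1-indexed: S k for k ∈ [1..N] (values outside the range are irrelevant).
-- Distance from (0,0) to (i,j) in the alignment graph, computed over the DAG:
-- dist(0,0)=0, dist(i,0)=dist(0,j)=∞ for i,j>0, and a vertex (i,j), i,j≥1, has exactly the
-- three entering edges of weight δ(S[i],T[j]).
dist : {A : Set} → (A → A → ℚ) → (ℕ → A) → (ℕ → A) → ℕ → ℕ → ℚ∞
dist δ S T zero zero = fin 0ℚ
dist δ S T (suc i) zero = ∞
dist δ S T zero (suc j) = ∞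
dist δ S T (suc i) (suc j) =
  min∞ (dist δ S T i (suc j)) (min∞ (dist δ S T (suc i) j) (dist δ S T i j))
    +∞ δ (S (suc i)) (T (suc j))

-- Inside a run of T the two columns j and j + 1 receive the same edge weights, so (as δ ≥ 0)
-- induction on the row shows dist(i, j) ≤ dist(i, j + 1) for every row i. Consequently, in
-- row i₁ of the block the edge from (i₁ - 1, j + 1) is never better than the diagonal one
-- from (i₁ - 1, j), and dist(i₁, j + 1) = min(dist(i₁, j), dist(i₁ - 1, j)) + c_B. Unrolling
-- this first-order min-plus recurrence gives the formula.
module Submission where

open import Defs
open import Data.Nat using (ℕ; _≤_; _<_; _+_; _∸_; suc)
open import Data.Sum using (_⊎_)
open import Data.Rational using (ℚ; 0ℚ) renaming (_<_ to _<ℚ_; _+_ to _+ℚ_)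
open import Relation.Binary.PropositionalEquality using (_≡_; _≢_)

open import Data.Nat using (zero; s≤s; z≤n)
open import Data.Nat.Properties
  using (+-suc; +-comm; n∸n≡0; +-∸-assoc; m≤o∸n⇒m+n≤o; m≤m+n; m≤n⇒m≤1+n)
  renaming (≤-refl to ≤-reflℕ; <⇒≤ to <⇒≤ℕ; +-identityʳ to +-identityʳℕ)
open import Data.Integer as ℤ using (ℤ; +_)
open import Data.Integer.Tactic.RingSolver using (solve-∀)
open import Data.Rational using (_/_; 1ℚ; -_; toℚᵘ) renaming (_≤_ to _≤ℚ_; _*_ to _*ℚ_)
open import Data.Rational.Properties
  using ( ≤-refl; ≤-reflexive; ≤-trans; <⇒≤; +-monoˡ-≤; +-monoʳ-≤; p⊓q≤p; p⊓q≤q; ⊓-glb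
        ; ⊓-assoc; p≥q⇒p⊓q≡q; mono-≤-distrib-⊓; +-assoc; +-identityʳ; +-inverseˡ
        ; *-zeroˡ; *-identityˡ; *-distribʳ-+; toℚᵘ-injective; toℚᵘ-fromℚᵘ; toℚᵘ-homo-+ )
import Data.Rational.Unnormalised as ℚᵘ
import Data.Rational.Unnormalised.Properties as ℚᵘ
open import Relation.Binary.PropositionalEquality
  using (refl; sym; trans; cong; cong₂; subst; module ≡-Reasoning)

infix 4 _≤∞_

data _≤∞_ : ℚ∞ → ℚ∞ → Set where
  fin≤fin : ∀ {a b} → a ≤ℚ b → fin a ≤∞ fin b
  ≤∞-top  : ∀ {x} → x ≤∞ ∞

≤∞-trans : ∀ {x y z} → x ≤∞ y → y ≤∞ z → x ≤∞ z
≤∞-trans (fin≤fin p) (fin≤fin q) = fin≤fin (≤-trans p q)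
≤∞-trans _           ≤∞-top      = ≤∞-top

min∞-≤ˡ : ∀ x y → min∞ x y ≤∞ x
min∞-≤ˡ (fin a) (fin b) = fin≤fin (p⊓q≤p a b)
min∞-≤ˡ (fin a) ∞       = fin≤fin ≤-refl
min∞-≤ˡ ∞       y       = ≤∞-top

min∞-≤ʳ : ∀ x y → min∞ x y ≤∞ y
min∞-≤ʳ (fin a) (fin b) = fin≤fin (p⊓q≤q a b)
min∞-≤ʳ (fin a) ∞       = ≤∞-top
min∞-≤ʳ ∞       (fin b) = fin≤fin ≤-refl
min∞-≤ʳ ∞       ∞       = ≤∞-top

min∞-glb : ∀ {x y z} → z ≤∞ x → z ≤∞ y → z ≤∞ min∞ x y
min∞-glb {x = ∞} _           z≤y         = z≤y
min∞-glb         (fin≤fin p) (fin≤fin q) = fin≤fin (⊓-glb p q)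
min∞-glb         (fin≤fin p) ≤∞-top      = fin≤fin p

y≤∞x⇒min∞xy≡y : ∀ {x y} → y ≤∞ x → min∞ x y ≡ y
y≤∞x⇒min∞xy≡y (fin≤fin p) = cong fin (p≥q⇒p⊓q≡q p)
y≤∞x⇒min∞xy≡y ≤∞-top      = refl

min∞-identityʳ : ∀ x → min∞ x ∞ ≡ x
min∞-identityʳ (fin a) = refl
min∞-identityʳ ∞       = refl

min∞-assoc : ∀ x y z → min∞ (min∞ x y) z ≡ min∞ x (min∞ y z)
min∞-assoc (fin a) (fin b) (fin c) = cong fin (⊓-assoc a b c)
min∞-assoc (fin a) (fin b) ∞       = refl
min∞-assoc (fin a) ∞       (fin c) = refl
min∞-assoc (fin a) ∞       ∞       = refl
min∞-assoc ∞       y       z       = refl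

+∞-assoc : ∀ x p q → x +∞ p +∞ q ≡ x +∞ (p +ℚ q)
+∞-assoc (fin a) p q = cong fin (+-assoc a p q)
+∞-assoc ∞       p q = refl

+∞-identityʳ : ∀ x → x +∞ 0ℚ ≡ x
+∞-identityʳ (fin a) = cong fin (+-identityʳ a)
+∞-identityʳ ∞       = refl

-∞-+∞-cancel : ∀ x c → x -∞ c +∞ c ≡ x
-∞-+∞-cancel x c = trans (+∞-assoc x (- c) c) (trans (cong (x +∞_) (+-inverseˡ c)) (+∞-identityʳ x))

+∞-monoˡ-≤∞ : ∀ c {x y} → x ≤∞ y → x +∞ c ≤∞ y +∞ c
+∞-monoˡ-≤∞ c (fin≤fin p) = fin≤fin (+-monoˡ-≤ c p)
+∞-monoˡ-≤∞ c ≤∞-top      = ≤∞-top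

x≤∞x+∞c : ∀ {c} → 0ℚ ≤ℚ c → ∀ x → x ≤∞ x +∞ c
x≤∞x+∞c 0≤c (fin a) = fin≤fin (≤-trans (≤-reflexive (sym (+-identityʳ a))) (+-monoʳ-≤ a 0≤c))
x≤∞x+∞c 0≤c ∞       = ≤∞-top

min∞-+∞-distrib : ∀ x y c → min∞ x y +∞ c ≡ min∞ (x +∞ c) (y +∞ c)
min∞-+∞-distrib (fin a) (fin b) c = cong fin (mono-≤-distrib-⊓ (+-monoˡ-≤ c) a b)
min∞-+∞-distrib (fin a) ∞       c = refl
min∞-+∞-distrib ∞       y       c = refl

min∞-+∞-glb : ∀ {x y z} c → z ≤∞ x +∞ c → z ≤∞ y +∞ c → z ≤∞ min∞ x y +∞ c
min∞-+∞-glb {x} {y} {z} c z≤x+c z≤y+c =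
  subst (z ≤∞_) (sym (min∞-+∞-distrib x y c)) (min∞-glb z≤x+c z≤y+c)

[1+n]/1≡n/1+1 : ∀ n → (+ suc n) / 1 ≡ (+ n) / 1 +ℚ 1ℚ
[1+n]/1≡n/1+1 n = toℚᵘ-injective (begin
  toℚᵘ (+ suc n / 1)              ≈⟨ toℚᵘ-fromℚᵘ (ℚᵘ.mkℚᵘ (+ suc n) 0) ⟩
  ℚᵘ.mkℚᵘ (+ suc n) 0             ≈⟨ ℚᵘ.*≡* (cross-multiplied (+ n)) ⟩
  ℚᵘ.mkℚᵘ (+ n) 0 ℚᵘ.+ ℚᵘ.1ℚᵘ     ≈⟨ ℚᵘ.+-congˡ ℚᵘ.1ℚᵘ (ℚᵘ.≃-sym (toℚᵘ-fromℚᵘ (ℚᵘ.mkℚᵘ (+ n) 0))) ⟩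
  toℚᵘ (+ n / 1) ℚᵘ.+ toℚᵘ 1ℚ     ≈⟨ ℚᵘ.≃-sym (toℚᵘ-homo-+ (+ n / 1) 1ℚ) ⟩
  toℚᵘ (+ n / 1 +ℚ 1ℚ)            ∎)
  where
  open ℚᵘ.≃-Reasoning
  cross-multiplied : ∀ (m : ℤ) → (+ 1 ℤ.+ m) ℤ.* + 1 ≡ (m ℤ.* + 1 ℤ.+ + 1 ℤ.* + 1) ℤ.* + 1
  cross-multiplied = solve-∀

·-suc : ∀ n c → suc n · c ≡ n · c +ℚ c
·-suc n c = begin
  (+ suc n / 1) *ℚ c              ≡⟨ cong (_*ℚ c) ([1+n]/1≡n/1+1 n) ⟩
  (+ n / 1 +ℚ 1ℚ) *ℚ c            ≡⟨ *-distribʳ-+ c (+ n / 1) 1ℚ ⟩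
  n · c +ℚ 1ℚ *ℚ c                ≡⟨ cong (n · c +ℚ_) (*-identityˡ c) ⟩
  n · c +ℚ c                      ∎
  where open ≡-Reasoning

+∞-·-suc : ∀ x n c → x +∞ n · c +∞ c ≡ x +∞ suc n · c
+∞-·-suc x n c = trans (+∞-assoc x (n · c) c) (cong (x +∞_) (sym (·-suc n c)))

+∞-0· : ∀ x c → x +∞ 0 · c ≡ x
+∞-0· x c = trans (cong (x +∞_) (*-zeroˡ c)) (+∞-identityʳ x)

minFrom1To-cong : ∀ {f g} k → (∀ y → y ≤ k → f y ≡ g y) → minFrom1To f k ≡ minFrom1To g k
minFrom1To-cong zero    f≗g = refl
minFrom1To-cong (suc k) f≗g =
  cong₂ min∞ (minFrom1To-cong k (λ y y≤k → f≗g y (m≤n⇒m≤1+n y≤k)))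
             (f≗g (suc k) ≤-reflℕ)

minFrom1To-+∞ : ∀ f c k → minFrom1To f k +∞ c ≡ minFrom1To (λ y → f y +∞ c) k
minFrom1To-+∞ f c zero    = refl
minFrom1To-+∞ f c (suc k) =
  trans (min∞-+∞-distrib (minFrom1To f k) (f (suc k)) c)
        (cong (λ m → min∞ m (f (suc k) +∞ c)) (minFrom1To-+∞ f c k))

closedForm : ℚ∞ → (ℕ → ℚ∞) → ℚ → ℕ → ℚ∞
closedForm r₀ g c y = min∞ (r₀ -∞ c +∞ y · c) (minFrom1To (λ y′ → g y′ +∞ (y ∸ y′) · c) y) +∞ c

min-plus-recurrence-solution : ∀ (r g : ℕ → ℚ∞) c n →
  (∀ y → suc y < n → r (suc y) ≡ min∞ (r y) (g (suc y)) +∞ c) →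
  ∀ y → y < n → r y ≡ closedForm (r 0) g c y
min-plus-recurrence-solution r g c n rec zero    _     = begin
  r 0                                   ≡⟨ sym (-∞-+∞-cancel (r 0) c) ⟩
  r 0 -∞ c +∞ c                         ≡⟨ cong (_+∞ c) (sym (+∞-0· (r 0 -∞ c) c)) ⟩
  r 0 -∞ c +∞ 0 · c +∞ c                ≡⟨ cong (_+∞ c) (sym (min∞-identityʳ _)) ⟩
  closedForm (r 0) g c 0                ∎
  where open ≡-Reasoning
min-plus-recurrence-solution r g c n rec (suc y) sy<n = begin
  r (suc y)                                          ≡⟨ rec y sy<n ⟩
  min∞ (r y) (g (suc y)) +∞ c                        ≡⟨ cong (λ x → min∞ x (g (suc y)) +∞ c) ih ⟩
  min∞ (min∞ (A y) (B y) +∞ c) (g (suc y)) +∞ c      ≡⟨ cong (λ x → min∞ x (g (suc y)) +∞ c)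
                                                          (min∞-+∞-distrib (A y) (B y) c) ⟩
  min∞ (min∞ (A y +∞ c) (B y +∞ c)) (g (suc y)) +∞ c ≡⟨ cong (_+∞ c) (min∞-assoc (A y +∞ c) _ _) ⟩
  min∞ (A y +∞ c) (min∞ (B y +∞ c) (g (suc y))) +∞ c ≡⟨ cong₂ (λ a b → min∞ a b +∞ c) A-step B-step ⟩
  min∞ (A (suc y)) (B (suc y)) +∞ c                  ∎
  where
  open ≡-Reasoning
  A : ℕ → ℚ∞
  A y = r 0 -∞ c +∞ y · c
  F : ℕ → ℕ → ℚ∞
  F y y′ = g y′ +∞ (y ∸ y′) · c
  B : ℕ → ℚ∞
  B y = minFrom1To (F y) y
  ih : r y ≡ min∞ (A y) (B y) +∞ c
  ih = min-plus-recurrence-solution r g c n rec y (<⇒≤ℕ sy<n)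
  A-step : A y +∞ c ≡ A (suc y)
  A-step = +∞-·-suc (r 0 -∞ c) y c
  F-step : ∀ y′ → y′ ≤ y → F y y′ +∞ c ≡ F (suc y) y′
  F-step y′ y′≤y = trans (+∞-·-suc (g y′) (y ∸ y′) c)
                         (cong (λ k → g y′ +∞ k · c) (sym (+-∸-assoc 1 y′≤y)))
  B-step : min∞ (B y +∞ c) (g (suc y)) ≡ B (suc y)
  B-step = cong₂ min∞
    (trans (minFrom1To-+∞ (F y) c y) (minFrom1To-cong y F-step))
    (sym (trans (cong (λ k → g (suc y) +∞ k · c) (n∸n≡0 y)) (+∞-0· (g (suc y)) c)))

module Distance {A : Set} (δ : A → A → ℚ) (δ-nonneg : ∀ a b → 0ℚ ≤ℚ δ a b) (S T : ℕ → A) where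

  d : ℕ → ℕ → ℚ∞
  d = dist δ S T

  dist-mono-run : ∀ j → T (suc j) ≡ T (suc (suc j)) → ∀ i → d i (suc j) ≤∞ d i (suc (suc j))
  dist-mono-run j same zero    = ≤∞-top
  dist-mono-run j same (suc i) =
    min∞-+∞-glb e (≤∞-trans left≤up+e (+∞-monoˡ-≤∞ e (dist-mono-run j same i)))
      (min∞-+∞-glb e (x≤∞x+∞c (δ-nonneg _ _) left) left≤up+e)
    where
    e : ℚ
    e = δ (S (suc i)) (T (suc (suc j)))
    left : ℚ∞
    left = d (suc i) (suc j)
    left≤up+e : left ≤∞ d i (suc j) +∞ e
    left≤up+e = subst (λ t → left ≤∞ d i (suc j) +∞ δ (S (suc i)) t) same
                      (+∞-monoˡ-≤∞ _ (min∞-≤ˡ (d i (suc j)) _))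

  dist-along-run : ∀ i j → T (suc j) ≡ T (suc (suc j)) →
    d (suc i) (suc (suc j)) ≡ min∞ (d (suc i) (suc j)) (d i (suc j)) +∞ δ (S (suc i)) (T (suc (suc j)))
  dist-along-run i j same = cong (_+∞ δ (S (suc i)) (T (suc (suc j))))
    (y≤∞x⇒min∞xy≡y (≤∞-trans (min∞-≤ʳ (d (suc i) (suc j)) _) (dist-mono-run j same i)))

  row-recurrence-in-run : ∀ i j n → (∀ y → y < n → T (suc j + y) ≡ T (suc j)) →
    ∀ y → suc y < n →
    d (suc i) (suc j + suc y)
      ≡ min∞ (d (suc i) (suc j + y)) (d i (suc j + suc y ∸ 1)) +∞ δ (S (suc i)) (T (suc j))
  row-recurrence-in-run i j n in-run y sy<n = begin
    d (suc i) (suc j + suc y)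
      ≡⟨ cong (d (suc i)) column ⟩
    d (suc i) (suc (suc (j + y)))
      ≡⟨ dist-along-run i (j + y) (trans (in-run y (<⇒≤ℕ sy<n)) (sym next-in-run)) ⟩
    min∞ (d (suc i) (suc (j + y))) (d i (suc (j + y))) +∞ δ (S (suc i)) (T (suc (suc (j + y))))
      ≡⟨ cong₂ (λ x t → min∞ (d (suc i) (suc (j + y))) x +∞ δ (S (suc i)) t)
               (cong (d i) (sym (+-suc j y))) next-in-run ⟩
    min∞ (d (suc i) (suc j + y)) (d i (suc j + suc y ∸ 1)) +∞ δ (S (suc i)) (T (suc j)) ∎
    where
    open ≡-Reasoning
    column : suc j + suc y ≡ suc (suc (j + y))
    column = cong suc (+-suc j y)
    next-in-run : T (suc (suc (j + y))) ≡ T (suc j)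
    next-in-run = trans (cong T (sym column)) (in-run (suc y) sy<n)

mainTheorem4 : {A : Set} (δ : A → A → ℚ) → (∀ a b → 0ℚ <ℚ δ a b) →
  (N M : ℕ) (S T : ℕ → A) (i₁ i₂ j₁ j₂ : ℕ) →
  1 ≤ i₁ → i₁ ≤ i₂ → i₂ ≤ N →
  (∀ k → i₁ ≤ k → k ≤ i₂ → S k ≡ S i₁) →
  (i₁ ≡ 1 ⊎ S (i₁ ∸ 1) ≢ S i₁) →
  (i₂ ≡ N ⊎ S (suc i₂) ≢ S i₂) →
  1 ≤ j₁ → j₁ ≤ j₂ → j₂ ≤ M →
  (∀ k → j₁ ≤ k → k ≤ j₂ → T k ≡ T j₁) →
  (j₁ ≡ 1 ⊎ T (j₁ ∸ 1) ≢ T j₁) →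
  (j₂ ≡ M ⊎ T (suc j₂) ≢ T j₂) →
  let c = δ (S i₁) (T j₁)
      w = suc j₂ ∸ j₁
      d = dist δ S T
  in (y : ℕ) → y < w →
     d i₁ (j₁ + y) ≡
       min∞ (d i₁ j₁ -∞ c +∞ (y · c))
            (minFrom1To (λ y′ → d (i₁ ∸ 1) (j₁ + y′ ∸ 1) +∞ ((y ∸ y′) · c)) y)
         +∞ c
mainTheorem4 δ δ-pos _ _ S T (suc i) _ (suc j) j₂
             (s≤s z≤n) _ _ _ _ _ (s≤s z≤n) j₁≤j₂ _ T-run _ _ y y<w =
  trans (min-plus-recurrence-solution r g c w (row-recurrence-in-run i j w in-run) y y<w)
        (cong (λ r₀ → closedForm r₀ g c y) (cong (d (suc i)) (+-identityʳℕ (suc j))))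
  where
  open Distance δ (λ a b → <⇒≤ (δ-pos a b)) S T
  c : ℚ
  c = δ (S (suc i)) (T (suc j))
  w : ℕ
  w = j₂ ∸ j
  r : ℕ → ℚ∞
  r y = d (suc i) (suc j + y)
  g : ℕ → ℚ∞
  g y′ = d i (suc j + y′ ∸ 1)
  in-run : ∀ y → y < w → T (suc j + y) ≡ T (suc j)
  in-run y y<w = T-run (suc j + y) (m≤m+n (suc j) y)
    (subst (_≤ j₂) (cong suc (+-comm y j)) (m≤o∸n⇒m+n≤o (suc y) (<⇒≤ℕ j₁≤j₂) y<w))
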